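{- Let $d\geq 2$ and let $[B_1,\dots,B_k]$ and $[B_1',\dots,B_k']$ be two ordered partitions of $[d+1]$ (viewed as faces of $\mathrm{Perm}_d$). If $[B_1',\dots,B_k']=[B_1,\dots,B_k]+v$ for some $v\in\Lambda_d$, then $[B_1',\dots,B_k']$ is a rotation of $[B_1,\dots,B_k]$, i.e. there is $j$ with $B_i'=B_{i+j}$ for all $i$, indices taken modulo $k$.
   Context: $\mathrm{Perm}_d=\operatorname{conv}\{(\sigma(1),\dots,\sigma(d+1)):\sigma\in\mathfrak S_{d+1}\}\subset\mathbb{R}^{d+1}$; $w_i=(d+1)e_i-\sum_je_j$ and $\Lambda_d=\{\sum a_iw_i: a_i\in\mathbb{Z}\}$ (equivalently, the vectors with coordinate sum $0$ whose pairwise coordinate differences are divisible by $d+1$). An ordered partition $[B_1,\dots,B_k]$ of $[d+1]$ labels the face of $\mathrm{Perm}_d$ given as the convex hull of all permutation vectors $(x_1,\dots,x_{d+1})$ of $[d+1]$ with $\{x_a: a\in B_i\}=\{b_{i-1}+1,\dots,b_i\}$ for all $i$, where $b_i=|B_1|+\dots+|B_i|$, $b_0=0$; $[B_1,\dots,B_k]+v$ is the translate of this face by $v$. -}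

module Defs where

open import Data.Nat as ℕ using (ℕ; zero; suc; _<_; _≤_; _<?_)
open import Data.Nat.DivMod using (_%_; m%n<n)
open import Data.Fin as Fin using (Fin; toℕ; fromℕ<)
open import Data.Fin.Properties using (_≟_)
open import Data.Fin.Permutation using (Permutation′; _⟨$⟩ʳ_)
open import Data.Integer as ℤ using (ℤ)
open import Data.Rational as ℚ using (ℚ; 0ℚ; 1ℚ)
open import Data.List using (List; []; _∷_; filter; length; map; foldr)
open import Data.List.Relation.Unary.All using (All)
open import Data.List.Base using (allFin)
open import Data.Product using (Σ; _×_; _,_; ∃; proj₁; proj₂)
open import Relation.Binary.PropositionalEquality using (_≡_)
open import Function.Bundles using (_⇔_)
open import Relation.Nullary.Decidable using (does)

-- Vectors in ℝ^n are represented by their rational points.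
Vecℚ : ℕ → Set
Vecℚ n = Fin n → ℚ

-- Ordered partitions [B₁,…,B_k] of [n] (here n = d+1, elements Fin n,
-- blocks indexed 0,…,k-1).  An ordered partition is given by the map
-- blk sending each element to the index of its block; B_i = blk⁻¹(i).

record OrderedPartition (n k : ℕ) : Set where
  field
    blk      : Fin n → Fin k
    nonempty : (i : Fin k) → ∃ λ a → blk a ≡ i
open OrderedPartition public

prefixSize : ∀ {n k} → OrderedPartition n k → ℕ → ℕ
prefixSize {n} B m = length (filter (λ a → toℕ (blk B a) <? m) (allFin n))

permVec : ∀ {n} → Permutation′ n → Fin n → ℕ
permVec σ a = suc (toℕ (σ ⟨$⟩ʳ a))

-- The vertex x of Perm belongs to the face labelled by B iff for every
-- block index i: {x_a : a ∈ B_i} = {b_{i-1}+1, …, b_i}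
-- (block i 0-indexed: {b(i)+1, …, b(i+1)}).
InFace : ∀ {n k} → OrderedPartition n k → Permutation′ n → Set
InFace {n} {k} B σ = (i : Fin k) → (m : ℕ) →
  (∃ λ a → blk B a ≡ i × permVec σ a ≡ m)
    ⇔ (prefixSize B (toℕ i) < m × m ≤ prefixSize B (suc (toℕ i)))

FaceVertex : ∀ {n k} → OrderedPartition n k → Vecℚ n → Set
FaceVertex {n} B x = ∃ λ (σ : Permutation′ n) →
  InFace B σ × ((a : Fin n) → x a ≡ ℤ.+ (permVec σ a) ℚ./ 1)

sumℚ : List ℚ → ℚ
sumℚ = foldr ℚ._+_ 0ℚ

ConvexHull : ∀ {n} → (Vecℚ n → Set) → Vecℚ n → Set
ConvexHull {n} S p = Σ (List (ℚ × Vecℚ n)) λ L →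
  All (λ cx → 0ℚ ℚ.≤ proj₁ cx × S (proj₂ cx)) L
  × sumℚ (map proj₁ L) ≡ 1ℚ
  × ((a : Fin n) → p a ≡ sumℚ (map (λ cx → proj₁ cx ℚ.* proj₂ cx a) L))

Face : ∀ {n k} → OrderedPartition n k → Vecℚ n → Set
Face B = ConvexHull (FaceVertex B)

Translate : ∀ {n} → (Vecℚ n → Set) → (Fin n → ℤ) → Vecℚ n → Set
Translate S v p = S (λ a → p a ℚ.- (v a ℚ./ 1))

-- Λ_d = { Σ a_i w_i : a_i ∈ ℤ },  w_i = (d+1) e_i − Σ_j e_j,  n = d+1.
sumℤ : ∀ {n} → (Fin n → ℤ) → ℤ
sumℤ {n} f = foldr ℤ._+_ (ℤ.+ 0) (map f (allFin n))

InLattice : (d : ℕ) → (Fin (suc d) → ℤ) → Set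
InLattice d v = ∃ λ (c : Fin (suc d) → ℤ) →
  (j : Fin (suc d)) → v j ≡ ℤ.+ (suc d) ℤ.* c j ℤ.- sumℤ c

addMod : ∀ {k} → Fin k → Fin k → Fin k
addMod {suc k} i j = fromℕ< (m%n<n (toℕ i ℕ.+ toℕ j) (suc k))

IsRotation : ∀ {n k} → OrderedPartition n k → OrderedPartition n k → Set
IsRotation {n} {k} B' B = ∃ λ (j : Fin k) → (i : Fin k) → (a : Fin n) →
  (blk B' a ≡ i ⇔ blk B a ≡ addMod i j)

{-# OPTIONS --safe #-}
module Submission where

-- The faces are cut out by x_a ∈ {b_{i-1}+1,…,b_i} for a ∈ B_i, intervals that partition
-- {1,…,d+1} in block order.  All coordinates of a lattice vector are congruent modulo d+1 and
-- both faces lie in [1,d+1]^{d+1}, so translating by v acts on the values of vertices as a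
-- cyclic shift.  Hence two elements taking the same value in two vertices of one face (obtained
-- by swapping them inside a block) lie in a common block of the other face: the blocks of B' are
-- relabelled blocks of B.  The last element of a block and the first element of the next one
-- have consecutive values in a vertex, so the relabelling sends consecutive blocks to cyclically
-- consecutive blocks, i.e. it is a rotation.

open import Defs
open import Data.Empty using (⊥-elim)
open import Data.Fin as Fin using (Fin; toℕ; fromℕ<; combine; punchOut)
open import Data.Fin.Properties
  using (toℕ<n; toℕ-fromℕ<; toℕ-injective; fromℕ<-injective; toℕ-combine; combine-injectiveʳ;
         ¬Fin0; _≟_; any?; pigeonhole; punchOut-injective)
import Data.Fin.Properties as Finₚ
open import Data.Fin.Permutation
  using (Permutation′; permutation; _⟨$⟩ʳ_; _⟨$⟩ˡ_; inverseʳ; transpose; _∘ₚ_)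
import Data.Fin.Permutation.Components as PC
open import Data.Integer as ℤ using (ℤ; +_; +[1+_]; -[1+_]; +≤+)
import Data.Integer.Properties as ℤₚ
open import Data.Integer.Tactic.RingSolver using (solve-∀)
open import Data.List using ([]; _∷_; map; filter; length; allFin)
open import Data.List.Properties using (length-filter; filter-all; filter-none; filter-≐; length-tabulate)
open import Data.List.Membership.Propositional using (_∈_)
open import Data.List.Membership.Propositional.Properties using (∈-allFin)
open import Data.List.Relation.Unary.Any using (here; there)
open import Data.List.Relation.Unary.All using (All; []; _∷_)
open import Data.List.Relation.Unary.All.Properties using (tabulate⁺)
open import Data.List.Relation.Binary.Sublist.Propositional using (⊆-refl)
open import Data.List.Relation.Binary.Sublist.Propositional.Properties using (filter⁺; length-mono-≤)
open import Data.Nat using (ℕ; zero; suc; _+_; _*_; _≤_; _<_; _<?_; z≤n; s≤s)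
open import Data.Nat.DivMod using (_%_; m<n⇒m%n≡m; n%n≡0; %-distribˡ-+; m%n%n≡m%n)
open import Data.Nat.Properties
  using (≤-refl; ≤-reflexive; ≤-trans; ≤-antisym; <-irrefl; <-trans; <-≤-trans; <-cmp; ≤-pred;
         <⇒≤; <⇒≢; <⇒≱; ≤⇒≯; ≮⇒≥; ≰⇒>; n≤1+n; n<1+n; 1+n≢n; n≤0⇒n≡0; m≤n⇒m≤1+n; m≤n⇒m<n∨m≡n;
         m≤m+n; m≤m*n; +-comm; *-suc; +-monoˡ-≤; +-monoʳ-≤; +-monoʳ-<; *-monoʳ-≤; module ≤-Reasoning)
open import Data.Product using (Σ; ∃; _×_; _,_; proj₁; proj₂)
open import Data.Rational as ℚ using (ℚ; 0ℚ; 1ℚ)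
import Data.Rational.Properties as ℚₚ
open import Data.Rational.Unnormalised as ℚᵘ using (mkℚᵘ)
import Data.Rational.Unnormalised.Properties as ℚᵘₚ
open import Data.Sum using (_⊎_; inj₁; inj₂; [_,_]′)
open import Function using (_∘_; id)
open import Function.Bundles using (_⇔_; mk⇔; Equivalence)
open import Function.Definitions using (Injective)
import Function.Properties.Equivalence as ⇔
open import Level using (0ℓ)
open import Relation.Binary using (tri<; tri≈; tri>)
open import Relation.Binary.PropositionalEquality
open import Relation.Nullary using (¬_; yes; no; contradiction)
open import Relation.Unary using (Pred; Decidable; _⊆_)

module _ {A : Set} {P Q : Pred A 0ℓ} (P? : Decidable P) (Q? : Decidable Q) (P⊆Q : P ⊆ Q) where

  length-filter-mono : ∀ xs → length (filter P? xs) ≤ length (filter Q? xs)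
  length-filter-mono xs = length-mono-≤ (filter⁺ P? Q? (λ { refl → P⊆Q }) (⊆-refl {x = xs}))

  length-filter-strict : ∀ {y xs} → y ∈ xs → Q y → ¬ P y →
                         length (filter P? xs) < length (filter Q? xs)
  length-filter-strict {xs = x ∷ xs} (here refl) qy ¬py with P? x | Q? x
  ... | yes py | _      = contradiction py ¬py
  ... | no _   | yes _  = s≤s (length-filter-mono xs)
  ... | no _   | no ¬qy = contradiction qy ¬qy
  length-filter-strict {xs = x ∷ xs} (there y∈xs) qy ¬py with P? x | Q? x
  ... | yes _  | yes _  = s≤s (length-filter-strict y∈xs qy ¬py)
  ... | yes px | no ¬qx = contradiction (P⊆Q px) ¬qx
  ... | no _   | yes _  = m≤n⇒m≤1+n (length-filter-strict y∈xs qy ¬py)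
  ... | no _   | no _   = length-filter-strict y∈xs qy ¬py

countBelow : ∀ {n} → (Fin n → ℕ) → ℕ → ℕ
countBelow {n} f c = length (filter (λ a → f a <? c) (allFin n))

countBelow-cong : ∀ {n} (f g : Fin n → ℕ) {c c'} → (∀ a → f a < c ⇔ g a < c') →
                  countBelow f c ≡ countBelow g c'
countBelow-cong f g f⇔g =
  cong length (filter-≐ _ _ ((λ {a} → Equivalence.to (f⇔g a)) , (λ {a} → Equivalence.from (f⇔g a))) (allFin _))

module _ {n : ℕ} (f : Fin n → ℕ) where

  countBelow-mono : ∀ {c c'} → c ≤ c' → countBelow f c ≤ countBelow f c'
  countBelow-mono c≤c' = length-filter-mono _ _ (λ lt → <-≤-trans lt c≤c') (allFin n)

  countBelow-strict : ∀ {c c'} a → c ≤ f a → f a < c' → countBelow f c < countBelow f c'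
  countBelow-strict a c≤fa fa<c' =
    length-filter-strict _ _ (λ lt → <-trans (<-≤-trans lt c≤fa) fa<c') (∈-allFin a) fa<c' (≤⇒≯ c≤fa)

  countBelow-≤ : ∀ c → countBelow f c ≤ n
  countBelow-≤ c = subst (countBelow f c ≤_) (length-tabulate id) (length-filter _ (allFin n))

  countBelow-all : ∀ {c} → (∀ a → f a < c) → countBelow f c ≡ n
  countBelow-all f<c = trans (cong length (filter-all _ (tabulate⁺ f<c))) (length-tabulate id)

  countBelow-zero : countBelow f 0 ≡ 0
  countBelow-zero = cong length (filter-none (λ a → f a <? 0) {allFin n} (tabulate⁺ (λ a ())))

  rank : Fin n → ℕ
  rank a = countBelow f (f a)

  rank-<-countBelow : ∀ a c → rank a < countBelow f c ⇔ f a < c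
  rank-<-countBelow a c = mk⇔
    (λ lt → ≰⇒> (λ c≤fa → <⇒≱ lt (countBelow-mono c≤fa)))
    (countBelow-strict a ≤-refl)

  rank<n : ∀ a → rank a < n
  rank<n a = <-≤-trans (Equivalence.from (rank-<-countBelow a (suc (f a))) ≤-refl) (countBelow-≤ _)

  rank-injective : Injective _≡_ _≡_ f → Injective _≡_ _≡_ rank
  rank-injective f-injective {a} {b} eq with <-cmp (f a) (f b)
  ... | tri< lt _ _ = contradiction eq (<⇒≢ (countBelow-strict a ≤-refl lt))
  ... | tri≈ _ e _  = f-injective e
  ... | tri> _ _ gt = contradiction (sym eq) (<⇒≢ (countBelow-strict b ≤-refl gt))

injective⇒surjective : ∀ {n} {f : Fin n → Fin n} → Injective _≡_ _≡_ f → ∀ y → ∃ λ x → f x ≡ y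
injective⇒surjective {zero}  f-injective ()
injective⇒surjective {suc n} {f} f-injective y with any? (λ x → f x ≟ y)
... | yes hit = hit
... | no miss with pigeonhole (n<1+n n) (λ x → punchOut (λ fx≡y → miss (x , sym fx≡y)))
... | x , x' , x<x' , eq = contradiction x<x'
  (Finₚ.<-irrefl (f-injective (punchOut-injective (λ e → miss (x , sym e)) (λ e → miss (x' , sym e)) eq)))

injective⇒permutation : ∀ {n} (f : Fin n → Fin n) → Injective _≡_ _≡_ f →
                        Σ (Permutation′ n) λ σ → ∀ a → σ ⟨$⟩ʳ a ≡ f a
injective⇒permutation f f-injective =
  permutation f (proj₁ ∘ surj) (proj₂ ∘ surj) (λ x → f-injective (proj₂ (surj (f x)))) , λ a → refl
  where
  surj : ∀ y → ∃ λ x → f x ≡ y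
  surj = injective⇒surjective f-injective

transpose-matchˡ : ∀ {n} (a b : Fin n) → PC.transpose a b a ≡ b
transpose-matchˡ a b with a ≟ a
... | yes _  = refl
... | no a≢a = contradiction refl a≢a

transpose-invariant : ∀ {n} {B : Set} (g : Fin n → B) {a b} → g a ≡ g b →
                      ∀ x → g (PC.transpose a b x) ≡ g x
transpose-invariant g {a} {b} ga≡gb x with x ≟ a
... | yes refl = sym ga≡gb
... | no _ with x ≟ b
...   | yes refl = ga≡gb
...   | no _     = refl

combine-<-*⇔ : ∀ {k n} (i : Fin k) (j : Fin n) t → toℕ (combine i j) < n * t ⇔ toℕ i < t
combine-<-*⇔ {n = n} i j t rewrite toℕ-combine i j = mk⇔
  (λ lt → ≰⇒> (λ t≤i → <⇒≱ lt (≤-trans (*-monoʳ-≤ n t≤i) (m≤m+n _ _))))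
  (λ i<t → begin-strict
    n * toℕ i + toℕ j  <⟨ +-monoʳ-< (n * toℕ i) (toℕ<n j) ⟩
    n * toℕ i + n      ≡⟨ trans (+-comm _ n) (sym (*-suc n (toℕ i))) ⟩
    n * suc (toℕ i)    ≤⟨ *-monoʳ-≤ n i<t ⟩
    n * t              ∎)
  where open ≤-Reasoning

module _ {n k : ℕ} (X : OrderedPartition n k) where

  InBlock : ℕ → Fin k → Set
  InBlock z i = prefixSize X (toℕ i) < z × z ≤ prefixSize X (suc (toℕ i))

  prefixSize-mono : ∀ {s t} → s ≤ t → prefixSize X s ≤ prefixSize X t
  prefixSize-mono = countBelow-mono (toℕ ∘ blk X)

  prefixSize-strict : ∀ {s t} → s < t → t ≤ k → prefixSize X s < prefixSize X t
  prefixSize-strict {s} s<t t≤k =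
    countBelow-strict (toℕ ∘ blk X) a (≤-reflexive (sym a∈s)) (subst (_< _) (sym a∈s) s<t)
    where
    s<k : s < k
    s<k = <-≤-trans s<t t≤k
    a : Fin n
    a = proj₁ (nonempty X (fromℕ< s<k))
    a∈s : toℕ (blk X a) ≡ s
    a∈s = trans (cong toℕ (proj₂ (nonempty X (fromℕ< s<k)))) (toℕ-fromℕ< s<k)

  prefixSize-zero : prefixSize X 0 ≡ 0
  prefixSize-zero = countBelow-zero (toℕ ∘ blk X)

  prefixSize-all : prefixSize X k ≡ n
  prefixSize-all = countBelow-all (toℕ ∘ blk X) (toℕ<n ∘ blk X)

  inBlock-bounds : ∀ {z i} → InBlock z i → 1 ≤ z × z ≤ n
  inBlock-bounds (P<z , z≤P) = <-≤-trans (s≤s z≤n) P<z , ≤-trans z≤P (countBelow-≤ (toℕ ∘ blk X) _)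

  inBlock-mono : ∀ {z z' i j} → z ≤ z' → InBlock z i → InBlock z' j → toℕ i ≤ toℕ j
  inBlock-mono z≤z' (Pi<z , _) (_ , z'≤Pj) =
    ≮⇒≥ (λ j<i → <-irrefl refl (<-≤-trans Pi<z (≤-trans z≤z' (≤-trans z'≤Pj (prefixSize-mono j<i)))))

  inBlock-unique : ∀ {z i j} → InBlock z i → InBlock z j → i ≡ j
  inBlock-unique z∈i z∈j =
    toℕ-injective (≤-antisym (inBlock-mono ≤-refl z∈i z∈j) (inBlock-mono ≤-refl z∈j z∈i))

  inBlock-suc : ∀ {z i j} → InBlock z i → InBlock (suc z) j → toℕ j ≡ toℕ i ⊎ toℕ j ≡ suc (toℕ i)
  inBlock-suc {z} {i} {j} z∈i@(_ , z≤Pi) 1+z∈j@(Pj<1+z , _) with m≤n⇒m<n∨m≡n j≤1+i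
    where
    j≤1+i : toℕ j ≤ suc (toℕ i)
    j≤1+i = ≮⇒≥ (λ 1+i<j → <-irrefl refl
      (<-≤-trans (prefixSize-strict 1+i<j (<⇒≤ (toℕ<n j))) (≤-trans (≤-pred Pj<1+z) z≤Pi)))
  ... | inj₁ j<1+i = inj₁ (≤-antisym (≤-pred j<1+i) (inBlock-mono (n≤1+n z) z∈i 1+z∈j))
  ... | inj₂ j≡1+i = inj₂ j≡1+i

  inBlock-1⇒first : ∀ {j} → InBlock 1 j → toℕ j ≡ 0
  inBlock-1⇒first {j} (Pj<1 , _) = n≤0⇒n≡0 (≮⇒≥ λ 0<j →
    <⇒≱ Pj<1 (subst (_< prefixSize X (toℕ j)) prefixSize-zero (prefixSize-strict 0<j (<⇒≤ (toℕ<n j)))))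

  inBlock-n⇒last : ∀ {i} → InBlock n i → suc (toℕ i) ≡ k
  inBlock-n⇒last {i} (_ , n≤P) with m≤n⇒m<n∨m≡n (toℕ<n i)
  ... | inj₂ 1+i≡k = 1+i≡k
  ... | inj₁ 1+i<k = contradiction
    (subst (prefixSize X (suc (toℕ i)) <_) prefixSize-all (prefixSize-strict 1+i<k ≤-refl)) (≤⇒≯ n≤P)

  blockStart-inBlock : ∀ i → InBlock (suc (prefixSize X (toℕ i))) i
  blockStart-inBlock i = ≤-refl , prefixSize-strict (n<1+n _) (toℕ<n i)

  blockEnd-inBlock : ∀ i → InBlock (prefixSize X (suc (toℕ i))) i
  blockEnd-inBlock i = prefixSize-strict (n<1+n _) (toℕ<n i) , ≤-refl

  InFace⇒inBlock : ∀ {σ} → InFace X σ → ∀ a → InBlock (permVec σ a) (blk X a)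
  InFace⇒inBlock {σ} σ∈X a = Equivalence.to (σ∈X (blk X a) (permVec σ a)) (a , refl , refl)

  inBlock⇒InFace : ∀ {σ} → (∀ a → InBlock (permVec σ a) (blk X a)) → InFace X σ
  inBlock⇒InFace {σ} σ-inBlock i m = mk⇔ (λ { (a , refl , refl) → σ-inBlock a }) (preimage m)
    where
    preimage : ∀ m → InBlock m i → ∃ λ a → blk X a ≡ i × permVec σ a ≡ m
    preimage (suc m) m∈i =
      a , inBlock-unique (subst (λ z → InBlock z (blk X a)) σa≡1+m (σ-inBlock a)) m∈i , σa≡1+m
      where
      m<n : m < n
      m<n = proj₂ (inBlock-bounds m∈i)
      a : Fin n
      a = σ ⟨$⟩ˡ fromℕ< m<n
      σa≡1+m : permVec σ a ≡ suc m
      σa≡1+m = cong suc (trans (cong toℕ (inverseʳ σ)) (toℕ-fromℕ< m<n))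

  InFace-transpose : ∀ {σ a b} → InFace X σ → blk X a ≡ blk X b → InFace X (transpose a b ∘ₚ σ)
  InFace-transpose {σ} {a} {b} σ∈X same = inBlock⇒InFace {transpose a b ∘ₚ σ} λ x →
    subst (InBlock _) (transpose-invariant (blk X) same x) (InFace⇒inBlock {σ} σ∈X (PC.transpose a b x))

  -- The vertex listing the elements by block and, within a block, by index: its value at a is
  -- one more than the number of elements below a in the lexicographic order encoded by key.
  private
    key : Fin n → ℕ
    key a = toℕ (combine (blk X a) a)

    key-injective : Injective _≡_ _≡_ key
    key-injective {a} {b} eq = combine-injectiveʳ (blk X a) a (blk X b) b (toℕ-injective eq)

    rank-<-prefixSize : ∀ a t → rank key a < prefixSize X t ⇔ toℕ (blk X a) < t
    rank-<-prefixSize a t = subst (λ c → rank key a < c ⇔ _) (sym prefix≡)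
      (⇔.trans (rank-<-countBelow key a (n * t)) (combine-<-*⇔ (blk X a) a t))
      where
      prefix≡ : prefixSize X t ≡ countBelow key (n * t)
      prefix≡ = countBelow-cong (toℕ ∘ blk X) key (λ b → ⇔.sym (combine-<-*⇔ (blk X b) b t))

    rank-inBlock : ∀ a → InBlock (suc (rank key a)) (blk X a)
    rank-inBlock a = s≤s (≮⇒≥ (λ lt → <-irrefl refl (Equivalence.to (rank-<-prefixSize a _) lt)))
                   , Equivalence.from (rank-<-prefixSize a _) (n<1+n _)

    position : Fin n → Fin n
    position a = fromℕ< (rank<n key a)

    position-injective : Injective _≡_ _≡_ position
    position-injective eq = rank-injective key key-injective (fromℕ<-injective _ _ _ _ eq)

  sortedVertex : Σ (Permutation′ n) (InFace X)
  sortedVertex with σ , σ≡position ← injective⇒permutation position position-injective =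
    σ , inBlock⇒InFace {σ} (λ a → subst (λ z → InBlock z (blk X a)) (sym (σ≡1+rank a)) (rank-inBlock a))
    where
    σ≡1+rank : ∀ a → permVec σ a ≡ suc (rank key a)
    σ≡1+rank a = cong suc (trans (cong toℕ (σ≡position a)) (toℕ-fromℕ< _))

fromℤ : ℤ → ℚ
fromℤ z = z ℚ./ 1

private
  toℚᵘ-fromℤ : ∀ z → ℚ.toℚᵘ (fromℤ z) ℚᵘ.≃ mkℚᵘ z 0
  toℚᵘ-fromℤ z = ℚₚ.toℚᵘ-fromℚᵘ (mkℚᵘ z 0)

fromℤ-sub : ∀ x y → fromℤ x ℚ.- fromℤ y ≡ fromℤ (x ℤ.- y)
fromℤ-sub x y = ℚₚ.toℚᵘ-injective (begin
  ℚ.toℚᵘ (fromℤ x ℚ.- fromℤ y)                  ≈⟨ ℚₚ.toℚᵘ-homo-+ (fromℤ x) (ℚ.- fromℤ y) ⟩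
  ℚ.toℚᵘ (fromℤ x) ℚᵘ.+ ℚ.toℚᵘ (ℚ.- fromℤ y)   ≈⟨ ℚᵘₚ.+-cong (toℚᵘ-fromℤ x) toℚᵘ-neg ⟩
  mkℚᵘ x 0 ℚᵘ.- mkℚᵘ y 0                        ≈⟨ ℚᵘ.*≡* (unit-denominators x y) ⟩
  mkℚᵘ (x ℤ.- y) 0                              ≈⟨ toℚᵘ-fromℤ (x ℤ.- y) ⟨
  ℚ.toℚᵘ (fromℤ (x ℤ.- y))                      ∎)
  where
  open ℚᵘₚ.≃-Reasoning
  toℚᵘ-neg : ℚ.toℚᵘ (ℚ.- fromℤ y) ℚᵘ.≃ ℚᵘ.- mkℚᵘ y 0
  toℚᵘ-neg = ℚᵘₚ.≃-trans (ℚₚ.toℚᵘ-homo‿- (fromℤ y)) (ℚᵘₚ.-‿cong (toℚᵘ-fromℤ y))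
  unit-denominators : ∀ x y → (x ℤ.* + 1 ℤ.+ ℤ.- y ℤ.* + 1) ℤ.* + 1 ≡ (x ℤ.- y) ℤ.* (+ 1 ℤ.* + 1)
  unit-denominators = solve-∀

fromℤ-≤⇔ : ∀ x y → fromℤ x ℚ.≤ fromℤ y ⇔ x ℤ.≤ y
fromℤ-≤⇔ x y = mk⇔
  (λ le → unit (ℚᵘₚ.≤-respʳ-≃ (toℚᵘ-fromℤ y) (ℚᵘₚ.≤-respˡ-≃ (toℚᵘ-fromℤ x) (ℚₚ.toℚᵘ-mono-≤ le))))
  (λ le → ℚₚ.toℚᵘ-cancel-≤
    (ℚᵘₚ.≤-respʳ-≃ (ℚᵘₚ.≃-sym (toℚᵘ-fromℤ y)) (ℚᵘₚ.≤-respˡ-≃ (ℚᵘₚ.≃-sym (toℚᵘ-fromℤ x))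
      (ℚᵘ.*≤* (subst₂ ℤ._≤_ (sym (ℤₚ.*-identityʳ x)) (sym (ℤₚ.*-identityʳ y)) le)))))
  where
  unit : mkℚᵘ x 0 ℚᵘ.≤ mkℚᵘ y 0 → x ℤ.≤ y
  unit (ℚᵘ.*≤* le) = subst₂ ℤ._≤_ (ℤₚ.*-identityʳ x) (ℤₚ.*-identityʳ y) le

module _ {n : ℕ} {S : Vecℚ n → Set} (a : Fin n) {lo hi : ℚ}
         (bounded : ∀ {x} → S x → lo ℚ.≤ x a × x a ℚ.≤ hi) where

  private
    weighted-bounds : ∀ {c x} → 0ℚ ℚ.≤ c → S x → lo ℚ.* c ℚ.≤ c ℚ.* x a × c ℚ.* x a ℚ.≤ hi ℚ.* c
    weighted-bounds {c} {x} 0≤c x∈S =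
      subst (lo ℚ.* c ℚ.≤_) (ℚₚ.*-comm (x a) c) (scale (proj₁ (bounded x∈S))) ,
      subst (ℚ._≤ hi ℚ.* c) (ℚₚ.*-comm (x a) c) (scale (proj₂ (bounded x∈S)))
      where
      scale : ∀ {p q} → p ℚ.≤ q → p ℚ.* c ℚ.≤ q ℚ.* c
      scale = ℚₚ.*-monoʳ-≤-nonNeg c {{ℚ.nonNegative 0≤c}}

    weightedSum-bounds : ∀ L → All (λ cx → 0ℚ ℚ.≤ proj₁ cx × S (proj₂ cx)) L →
      lo ℚ.* sumℚ (map proj₁ L) ℚ.≤ sumℚ (map (λ cx → proj₁ cx ℚ.* proj₂ cx a) L) ×
      sumℚ (map (λ cx → proj₁ cx ℚ.* proj₂ cx a) L) ℚ.≤ hi ℚ.* sumℚ (map proj₁ L)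
    weightedSum-bounds [] [] = ℚₚ.≤-reflexive (ℚₚ.*-zeroʳ lo) , ℚₚ.≤-reflexive (sym (ℚₚ.*-zeroʳ hi))
    weightedSum-bounds ((c , x) ∷ L) ((0≤c , x∈S) ∷ L∈S) =
      let head-lo , head-hi = weighted-bounds 0≤c x∈S
          tail-lo , tail-hi = weightedSum-bounds L L∈S
      in subst (ℚ._≤ _) (sym (ℚₚ.*-distribˡ-+ lo c _)) (ℚₚ.+-mono-≤ head-lo tail-lo) ,
         subst (_ ℚ.≤_) (sym (ℚₚ.*-distribˡ-+ hi c _)) (ℚₚ.+-mono-≤ head-hi tail-hi)

  convexHull-bounded : ∀ {p} → ConvexHull S p → lo ℚ.≤ p a × p a ℚ.≤ hi
  convexHull-bounded {p} (L , L∈S , total , p≡) =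
    let lo≤ , ≤hi = weightedSum-bounds L L∈S
    in subst₂ ℚ._≤_ (trans (cong (lo ℚ.*_) total) (ℚₚ.*-identityʳ lo)) (sym (p≡ a)) lo≤ ,
       subst₂ ℚ._≤_ (sym (p≡ a)) (trans (cong (hi ℚ.*_) total) (ℚₚ.*-identityʳ hi)) ≤hi

singleton-convexHull : ∀ {n} {S : Vecℚ n → Set} {x p} → S x → (∀ a → p a ≡ x a) → ConvexHull S p
singleton-convexHull {x = x} x∈S p≡x =
  ((1ℚ , x) ∷ []) , ((ℚ.*≤* (+≤+ z≤n) , x∈S) ∷ []) , ℚₚ.+-identityʳ 1ℚ ,
  λ a → trans (p≡x a) (sym (trans (ℚₚ.+-identityʳ _) (ℚₚ.*-identityˡ _)))

module _ {n k : ℕ} (X : OrderedPartition n k) where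

  vertex∈Face : ∀ {σ p} → InFace X σ → (∀ a → p a ≡ fromℤ (+ permVec σ a)) → Face X p
  vertex∈Face {σ} σ∈X = singleton-convexHull (σ , σ∈X , λ a → refl)

  face-latticePoint : ∀ {p} → Face X p → ∀ a {z} → p a ≡ fromℤ z →
                      ∃ λ ζ → z ≡ + ζ × InBlock X ζ (blk X a)
  face-latticePoint {p} p∈X a {z} pa≡z = lattice z
    (Equivalence.to (fromℤ-≤⇔ lo z) (subst (_ ℚ.≤_) pa≡z (proj₁ pa-bounds)))
    (Equivalence.to (fromℤ-≤⇔ z hi) (subst (ℚ._≤ _) pa≡z (proj₂ pa-bounds)))
    where
    lo hi : ℤ
    lo = + suc (prefixSize X (toℕ (blk X a)))
    hi = + prefixSize X (suc (toℕ (blk X a)))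
    vertex-bounds : ∀ {x} → FaceVertex X x → fromℤ lo ℚ.≤ x a × x a ℚ.≤ fromℤ hi
    vertex-bounds (σ , σ∈X , x≡σ) = let lo<σa , σa≤hi = InFace⇒inBlock X {σ} σ∈X a in
      subst (fromℤ lo ℚ.≤_) (sym (x≡σ a)) (Equivalence.from (fromℤ-≤⇔ lo _) (+≤+ lo<σa)) ,
      subst (ℚ._≤ fromℤ hi) (sym (x≡σ a)) (Equivalence.from (fromℤ-≤⇔ _ hi) (+≤+ σa≤hi))
    pa-bounds : fromℤ lo ℚ.≤ p a × p a ℚ.≤ fromℤ hi
    pa-bounds = convexHull-bounded a vertex-bounds p∈X
    lattice : ∀ z → lo ℤ.≤ z → z ℤ.≤ hi → ∃ λ ζ → z ≡ + ζ × InBlock X ζ (blk X a)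
    lattice (+ ζ) (+≤+ lo≤ζ) (+≤+ ζ≤hi) = ζ , refl , lo≤ζ , ζ≤hi

infix 4 _≡_[mod_]
_≡_[mod_] : ℤ → ℤ → ℕ → Set
x ≡ y [mod n ] = ∃ λ m → x ≡ y ℤ.+ + n ℤ.* m

module _ {n : ℕ} where

  mod-trans : ∀ {x y z} → x ≡ y [mod n ] → y ≡ z [mod n ] → x ≡ z [mod n ]
  mod-trans {z = z} (m , x≡y) (m' , y≡z) =
    m' ℤ.+ m , trans x≡y (trans (cong (ℤ._+ + n ℤ.* m) y≡z) (regroup z (+ n) m' m))
    where
    regroup : ∀ z N m' m → (z ℤ.+ N ℤ.* m') ℤ.+ N ℤ.* m ≡ z ℤ.+ N ℤ.* (m' ℤ.+ m)
    regroup = solve-∀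

  mod-neg : ∀ {x y} → x ≡ y [mod n ] → ℤ.- x ≡ ℤ.- y [mod n ]
  mod-neg {y = y} (m , x≡y) = ℤ.- m , trans (cong ℤ.-_ x≡y) (distrib y (+ n) m)
    where
    distrib : ∀ y N m → ℤ.- (y ℤ.+ N ℤ.* m) ≡ ℤ.- y ℤ.+ N ℤ.* ℤ.- m
    distrib = solve-∀

  mod-+ˡ : ∀ x {y z} → y ≡ z [mod n ] → x ℤ.+ y ≡ x ℤ.+ z [mod n ]
  mod-+ˡ x {z = z} (m , y≡z) = m , trans (cong (ℤ._+_ x) y≡z) (sym (ℤₚ.+-assoc x z (+ n ℤ.* m)))

  mod-1+n≡1 : + suc n ≡ + 1 [mod n ]
  mod-1+n≡1 = + 1 , cong (ℤ._+_ (+ 1)) (sym (ℤₚ.*-identityʳ (+ n)))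

  private
    no-positive-multiple : ∀ {x y} m → 1 ≤ y → x ≤ n → + x ≢ + y ℤ.+ + n ℤ.* + suc m
    no-positive-multiple {x} {y} m 1≤y x≤n eq = <-irrefl refl (begin-strict
      x               ≤⟨ x≤n ⟩
      n               <⟨ +-monoˡ-≤ n 1≤y ⟩
      y + n           ≤⟨ +-monoʳ-≤ y (m≤m*n n (suc m)) ⟩
      y + n * suc m   ≡⟨ ℤₚ.+-injective (trans eq (cong (ℤ._+_ (+ y)) (sym (ℤₚ.pos-* n (suc m))))) ⟨
      x               ∎)
      where open ≤-Reasoning

  mod-unique : ∀ {x y} → 1 ≤ x × x ≤ n → 1 ≤ y × y ≤ n → + x ≡ + y [mod n ] → x ≡ y
  mod-unique {y = y} _ _ (+ zero , x≡y) =
    ℤₚ.+-injective (trans x≡y (trans (cong (ℤ._+_ (+ y)) (ℤₚ.*-zeroʳ (+ n))) (ℤₚ.+-identityʳ (+ y))))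
  mod-unique (_ , x≤n) (1≤y , _) (+[1+ m ] , x≡y) = contradiction x≡y (no-positive-multiple m 1≤y x≤n)
  mod-unique {x} {y} (1≤x , _) (_ , y≤n) (-[1+ m ] , x≡y) = contradiction
    (trans (unshift (+ y) (+ n) (+ suc m)) (cong (ℤ._+ + n ℤ.* + suc m) (sym x≡y)))
    (no-positive-multiple m 1≤x y≤n)
    where
    unshift : ∀ y N j → y ≡ (y ℤ.+ N ℤ.* ℤ.- j) ℤ.+ N ℤ.* j
    unshift = solve-∀

lattice⇒congruent : ∀ {d v} → InLattice d v → ∀ a e → v a ≡ v e [mod suc d ]
lattice⇒congruent {d} (c , v≡) a e = c a ℤ.- c e ,
  trans (v≡ a) (trans (split (+ suc d) (c a) (c e) (sumℤ c))
                      (cong (ℤ._+ + suc d ℤ.* (c a ℤ.- c e)) (sym (v≡ e))))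
  where
  split : ∀ N ca ce S → N ℤ.* ca ℤ.- S ≡ (N ℤ.* ce ℤ.- S) ℤ.+ N ℤ.* (ca ℤ.- ce)
  split = solve-∀

VerticesShiftInto : ∀ {n k l} → OrderedPartition n k → (Fin n → ℤ) → OrderedPartition n l → Set
VerticesShiftInto X w Y = ∀ σ → InFace X σ → ∀ a →
  ∃ λ ζ → + permVec σ a ℤ.+ w a ≡ + ζ × InBlock Y ζ (blk Y a)

module _ {n k : ℕ} {B B' : OrderedPartition n k} {v : Fin n → ℤ}
         (B'≡B+v : (p : Vecℚ n) → Face B' p ⇔ Translate (Face B) v p) where

  translation⇒shift : VerticesShiftInto B' (ℤ.-_ ∘ v) B
  translation⇒shift σ σ∈B' a =
    face-latticePoint B (Equivalence.to (B'≡B+v p) (vertex∈Face B' {σ} σ∈B' λ _ → refl)) a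
      (fromℤ-sub (+ permVec σ a) (v a))
    where
    p : Vecℚ n
    p b = fromℤ (+ permVec σ b)

  translation⇒shift⁻¹ : VerticesShiftInto B v B'
  translation⇒shift⁻¹ τ τ∈B a =
    face-latticePoint B' (Equivalence.from (B'≡B+v p) (vertex∈Face B {τ} τ∈B p-v≡τ)) a refl
    where
    p : Vecℚ n
    p b = fromℤ (+ permVec τ b ℤ.+ v b)
    cancel : ∀ x y → (x ℤ.+ y) ℤ.- y ≡ x
    cancel = solve-∀
    p-v≡τ : ∀ b → p b ℚ.- fromℤ (v b) ≡ fromℤ (+ permVec τ b)
    p-v≡τ b = trans (fromℤ-sub (+ permVec τ b ℤ.+ v b) (v b)) (cong fromℤ (cancel (+ permVec τ b) (v b)))

module _ {n k l : ℕ} (X : OrderedPartition n k) (Y : OrderedPartition n l) {w : Fin n → ℤ}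
         (shift : VerticesShiftInto X w Y) (w-cong : ∀ a e → w a ≡ w e [mod n ]) where

  shift-equalValues : ∀ {σ τ a e} → InFace X σ → InFace X τ → permVec σ a ≡ permVec τ e →
                      blk Y a ≡ blk Y e
  shift-equalValues {σ} {τ} {a} {e} σ∈X τ∈X σa≡τe =
    let ζa , a-shift , ζa∈ = shift σ σ∈X a
        ζe , e-shift , ζe∈ = shift τ τ∈X e
        ζa≡ζe = mod-unique (inBlock-bounds Y ζa∈) (inBlock-bounds Y ζe∈)
          (subst₂ _≡_[mod n ] (trans (cong (λ t → + t ℤ.+ w a) (sym σa≡τe)) a-shift) e-shift
            (mod-+ˡ {n} (+ permVec τ e) {w a} {w e} (w-cong a e)))
    in inBlock-unique Y (subst (λ ζ → InBlock Y ζ (blk Y a)) ζa≡ζe ζa∈) ζe∈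

  sameBlock-transfer : ∀ {a e} → blk X a ≡ blk X e → blk Y a ≡ blk Y e
  sameBlock-transfer {a} {e} same =
    let σ , σ∈X = sortedVertex X
    in shift-equalValues {transpose a e ∘ₚ σ} {σ} {a} {e} (InFace-transpose X {σ} {a} {e} σ∈X same) σ∈X
                         (cong (λ x → suc (toℕ (σ ⟨$⟩ʳ x))) (transpose-matchˡ a e))

module _ {n k : ℕ} (Y : OrderedPartition n (suc k)) where

  inBlock-cyclicSuc : ∀ {ζ ζ' i j} → InBlock Y ζ i → InBlock Y ζ' j → + ζ' ≡ + suc ζ [mod n ] →
                      j ≡ i ⊎ toℕ j ≡ suc (toℕ i) % suc k
  inBlock-cyclicSuc {ζ} {ζ'} {i} {j} ζ∈i ζ'∈j ζ'≡1+ζ with m≤n⇒m<n∨m≡n (proj₂ (inBlock-bounds Y ζ∈i))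
  ... | inj₁ ζ<n with inBlock-suc Y ζ∈i (subst (λ t → InBlock Y t j) ζ'≡1+ζ' ζ'∈j)
    where
    ζ'≡1+ζ' : ζ' ≡ suc ζ
    ζ'≡1+ζ' = mod-unique (inBlock-bounds Y ζ'∈j) (s≤s z≤n , ζ<n) ζ'≡1+ζ
  ...   | inj₁ j≡i   = inj₁ (toℕ-injective j≡i)
  ...   | inj₂ j≡1+i = inj₂ (trans j≡1+i (sym (m<n⇒m%n≡m (subst (_< suc k) j≡1+i (toℕ<n j)))))
  inBlock-cyclicSuc {ζ} {ζ'} {i} {j} ζ∈i ζ'∈j ζ'≡1+ζ | inj₂ ζ≡n =
    inj₂ (trans (inBlock-1⇒first Y (subst (λ t → InBlock Y t j) ζ'≡1 ζ'∈j)) (sym (trans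
      (cong (_% suc k) (inBlock-n⇒last Y (subst (λ t → InBlock Y t i) ζ≡n ζ∈i))) (n%n≡0 (suc k)))))
    where
    1≤n : 1 ≤ n
    1≤n = ≤-trans (proj₁ (inBlock-bounds Y ζ∈i)) (proj₂ (inBlock-bounds Y ζ∈i))
    ζ'≡1 : ζ' ≡ 1
    ζ'≡1 = mod-unique (inBlock-bounds Y ζ'∈j) (≤-refl , 1≤n) (mod-trans {n} {+ ζ'} {+ suc ζ} {+ 1} ζ'≡1+ζ
      (subst (λ t → + suc t ≡ + 1 [mod n ]) (sym ζ≡n) mod-1+n≡1))

module _ {n k : ℕ} (X Y : OrderedPartition n (suc k)) {w : Fin n → ℤ}
         (shift : VerticesShiftInto X w Y) (w-cong : ∀ a e → w a ≡ w e [mod n ]) where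

  shift-successiveValues : ∀ {σ a b} → InFace X σ → permVec σ b ≡ suc (permVec σ a) →
                           blk Y b ≡ blk Y a ⊎ toℕ (blk Y b) ≡ suc (toℕ (blk Y a)) % suc k
  shift-successiveValues {σ} {a} {b} σ∈X σb≡1+σa =
    let ζa , a-shift , ζa∈ = shift σ σ∈X a
        ζb , b-shift , ζb∈ = shift σ σ∈X b
        ζb≡1+ζa = subst₂ _≡_[mod n ]
          (trans (cong (λ t → + t ℤ.+ w b) (sym σb≡1+σa)) b-shift)
          (trans (ℤₚ.+-assoc (+ 1) (+ permVec σ a) (w a)) (cong (ℤ._+_ (+ 1)) a-shift))
          (mod-+ˡ {n} (+ suc (permVec σ a)) {w b} {w a} (w-cong b a))
    in inBlock-cyclicSuc Y ζa∈ ζb∈ ζb≡1+ζa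

  -- The last element of block i and the first element of block i+1 have consecutive values.
  relabelling-suc : ∀ {φ : Fin (suc k) → Fin (suc k)} → Injective _≡_ _≡_ φ → (∀ a → blk Y a ≡ φ (blk X a)) →
                    ∀ {i j} → toℕ j ≡ suc (toℕ i) → toℕ (φ j) ≡ suc (toℕ (φ i)) % suc k
  relabelling-suc {φ} φ-injective relabel {i} {j} j≡1+i =
    let σ , σ∈X = sortedVertex X
        a , a∈i , σa≡ = Equivalence.from (σ∈X i _) (blockEnd-inBlock X i)
        b , b∈j , σb≡ = Equivalence.from (σ∈X j _)
          (subst (λ t → InBlock X (suc (prefixSize X t)) j) j≡1+i (blockStart-inBlock X j))
    in [ (λ φj≡φi → contradiction (trans (sym j≡1+i) (cong toℕ (φ-injective φj≡φi))) 1+n≢n) , id ]′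
       (subst₂ (λ y x → y ≡ x ⊎ toℕ y ≡ suc (toℕ x) % suc k)
               (trans (relabel b) (cong φ b∈j)) (trans (relabel a) (cong φ a∈i))
               (shift-successiveValues {σ} {a} {b} σ∈X (trans σb≡ (cong suc (sym σa≡)))))

private
  suc-% : ∀ a k → suc (a % suc k) % suc k ≡ suc a % suc k
  suc-% a k = trans (%-distribˡ-+ 1 (a % suc k) (suc k))
    (trans (cong (λ r → (1 % suc k + r) % suc k) (m%n%n≡m%n a (suc k))) (sym (%-distribˡ-+ 1 a (suc k))))

suc-equivariant⇒rotation : ∀ {k} (φ : Fin (suc k) → Fin (suc k)) →
  (∀ {i j} → toℕ j ≡ suc (toℕ i) → toℕ (φ j) ≡ suc (toℕ (φ i)) % suc k) →
  ∀ i → φ i ≡ addMod i (φ Fin.zero)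
suc-equivariant⇒rotation {k} φ φ-suc i = toℕ-injective (trans (shifted (toℕ i) i refl) (sym (toℕ-fromℕ< _)))
  where
  j : ℕ
  j = toℕ (φ Fin.zero)
  shifted : ∀ t i → toℕ i ≡ t → toℕ (φ i) ≡ (t + j) % suc k
  shifted zero    i i≡0   = trans (cong (toℕ ∘ φ) (toℕ-injective i≡0)) (sym (m<n⇒m%n≡m (toℕ<n (φ Fin.zero))))
  shifted (suc t) i i≡1+t = begin
    toℕ (φ i)                      ≡⟨ φ-suc (trans i≡1+t (cong suc (sym (toℕ-fromℕ< t<1+k)))) ⟩
    suc (toℕ (φ i')) % suc k       ≡⟨ cong (λ r → suc r % suc k) (shifted t i' (toℕ-fromℕ< t<1+k)) ⟩
    suc ((t + j) % suc k) % suc k  ≡⟨ suc-% (t + j) k ⟩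
    suc (t + j) % suc k            ∎
    where
    open ≡-Reasoning
    t<1+k : t < suc k
    t<1+k = <-trans (n<1+n t) (subst (_< suc k) i≡1+t (toℕ<n i))
    i' : Fin (suc k)
    i' = fromℕ< t<1+k

blockRelabelling : ∀ {n k l} (X : OrderedPartition n k) (Y : OrderedPartition n l) →
  (∀ {a e} → blk X a ≡ blk X e → blk Y a ≡ blk Y e) →
  (∀ {a e} → blk Y a ≡ blk Y e → blk X a ≡ blk X e) →
  Σ (Fin k → Fin l) λ φ → Injective _≡_ _≡_ φ × ∀ a → blk Y a ≡ φ (blk X a)
blockRelabelling {n} {k} X Y X⇒Y Y⇒X =
  blk Y ∘ representative ,
  (λ {i} {j} eq → trans (sym (representative∈ i)) (trans (Y⇒X eq) (representative∈ j))) ,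
  λ a → X⇒Y (sym (representative∈ (blk X a)))
  where
  representative : Fin k → Fin n
  representative i = proj₁ (nonempty X i)
  representative∈ : ∀ i → blk X (representative i) ≡ i
  representative∈ i = proj₂ (nonempty X i)

rotatingRelabelling⇒IsRotation : ∀ {n k} {X Y : OrderedPartition n k} {φ : Fin k → Fin k} {j} →
  Injective _≡_ _≡_ φ → (∀ a → blk Y a ≡ φ (blk X a)) → (∀ i → φ i ≡ addMod i j) → IsRotation X Y
rotatingRelabelling⇒IsRotation {φ = φ} {j} φ-injective relabel rotation = j , λ i a → mk⇔
  (λ a∈i → trans (relabel a) (trans (cong φ a∈i) (rotation i)))
  (λ a∈i+j → φ-injective (trans (sym (relabel a)) (trans a∈i+j (sym (rotation i)))))

lemma5p3 : (d : ℕ) → 2 ≤ d → (k : ℕ) → (B B' : OrderedPartition (suc d) k) →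
    (v : Fin (suc d) → ℤ) → InLattice d v →
    ((p : Vecℚ (suc d)) → Face B' p ⇔ Translate (Face B) v p) →
    IsRotation B' B
lemma5p3 d _ zero B _ _ _ _ = ⊥-elim (¬Fin0 (blk B Fin.zero))
lemma5p3 d _ (suc k) B B' v v∈Λ B'≡B+v =
  let φ , φ-injective , relabel = blockRelabelling B' B (sameBlock-transfer B' B forward -v-cong)
                                                  (sameBlock-transfer B B' backward v-cong)
  in rotatingRelabelling⇒IsRotation {X = B'} {B} φ-injective relabel
       (suc-equivariant⇒rotation φ (relabelling-suc B' B forward -v-cong φ-injective relabel))
  where
  v-cong : ∀ a e → v a ≡ v e [mod suc d ]
  v-cong = lattice⇒congruent v∈Λ
  -v-cong : ∀ a e → ℤ.- v a ≡ ℤ.- v e [mod suc d ]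
  -v-cong a e = mod-neg {suc d} {v a} {v e} (v-cong a e)
  forward : VerticesShiftInto B' (ℤ.-_ ∘ v) B
  forward = translation⇒shift {B = B} {B'} {v} B'≡B+v
  backward : VerticesShiftInto B v B'
  backward = translation⇒shift⁻¹ {B = B} {B'} {v} B'≡B+v
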